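{- Let $q$ be an odd prime power and let $\gamma,\delta\in\mathbb{F}_{q^2}$ with $\gamma\neq 0$. Then the polynomial $$f(x)=(x^q-x+\delta)^{2}+\gamma x$$ is a permutation polynomial of $\mathbb{F}_{q^2}$ if and only if $\gamma\in\mathbb{F}_q^*$ and $\mathrm{Tr}_q^{q^2}(\delta)-\mathrm{Tr}_q^{q^2}(\gamma)/4\neq 0$.
   Context: A polynomial over a finite field $\mathbb{F}$ is a permutation polynomial of $\mathbb{F}$ if the map it induces on $\mathbb{F}$ is a bijection. For $x\in\mathbb{F}_{q^2}$, $\mathrm{Tr}_q^{q^2}(x)=x+x^q$. -}

module Defs where

open import Level using (Level; suc; _⊔_)
open import Data.Nat using (ℕ) renaming (suc to sucℕ; _^_ to _^ℕ_)
open import Data.Nat.Primality using (Prime)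
open import Data.Nat.Divisibility using (_∣_)
open import Data.Fin using (Fin)
open import Data.Product using (∃; ∃₂; _×_)
open import Relation.Nullary using (¬_)
open import Relation.Binary.PropositionalEquality using (_≡_)
import Relation.Binary.PropositionalEquality as ≡
open import Algebra.Bundles using (CommutativeRing; Semiring)
open import Function.Bundles using (Bijection)
import Function.Definitions as FD
import Algebra.Definitions.RawSemiring as RS

record Field (c ℓ : Level) : Set (suc (c ⊔ ℓ)) where
  field
    commutativeRing : CommutativeRing c ℓ
  open CommutativeRing commutativeRing public
  field
    _⁻¹       : Carrier → Carrier
    1≉0       : ¬ (1# ≈ 0#)
    ⁻¹-inverse : ∀ x → ¬ (x ≈ 0#) → (x * (x ⁻¹)) ≈ 1#
  infix 8 _⁻¹

  open RS (Semiring.rawSemiring semiring) public using (_^_)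

  IsPermutation : (Carrier → Carrier) → Set (c ⊔ ℓ)
  IsPermutation f = FD.Bijective _≈_ _≈_ f

  Tr : ℕ → Carrier → Carrier
  Tr q x = x + (x ^ q)

  InSubfield : ℕ → Carrier → Set ℓ
  InSubfield q x = (x ^ q) ≈ x

  four : Carrier
  four = 1# + 1# + 1# + 1#

HasCardinality : ∀ {c ℓ} → Field c ℓ → ℕ → Set (c ⊔ ℓ)
HasCardinality F n = Bijection (CommutativeRing.setoid (Field.commutativeRing F)) (≡.setoid (Fin n))

IsPrimePower : ℕ → Set
IsPrimePower q = ∃₂ λ p k → Prime p × q ≡ p ^ℕ sucℕ k

Odd : ℕ → Set
Odd q = ¬ (2 ∣ q)

module Submission where

-- Let σ x = x ^ q, an involution of 𝔽_{q²} fixing exactly 𝔽_q (additive by the binomial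
-- theorem in characteristic p, involutive because x ^ (q²) = x by Lagrange's theorem), and
-- T x = σ x - x, so that f x = (T x + δ)² + γ x. Everything is governed by z = γ - 2 Tr δ:
-- applying σ to f gives
--   σ (f x) - f x = (σ δ² - δ²) + (σ (z x) - z x).
-- If z ∈ 𝔽_q^*, the right-hand side is a constant plus z T x, so f x = f y forces T x = T y
-- and then γ x = γ y: f is injective, hence bijective. Conversely, if σ (z h) = z h but
-- σ h ≠ h, then ρ = 2δ + T h + γ h / T h satisfies σ ρ = -ρ, so x = ρ / 4 has 2 T x = -ρ, and
-- this makes f (x + h) = f x. So when f is injective, z h ∈ 𝔽_q implies h ∈ 𝔽_q: taking
-- h = z⁻¹ gives z ∈ 𝔽_q, and z = 0 would make σ the identity, which is impossible because
-- X^(q-1) - 1 cannot vanish on all q² - 1 nonzero elements. Finally, for γ ∈ 𝔽_q one has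
-- z = -2 (Tr δ - Tr γ / 4), and 2 ≠ 0 as q is odd.

open import Defs
open import Level using (Level)
open import Data.Nat using (ℕ) renaming (_*_ to _*ℕ_; _^_ to _^ℕ_)
open import Data.Nat.Primality using (Prime)
open import Relation.Binary.PropositionalEquality using (_≡_)
open import Relation.Nullary using (¬_)
open import Function.Bundles using (_⇔_)
open import Algebra.Bundles using (CommutativeRing; CommutativeSemiring; CommutativeMonoid)

module IntegerCoefficients {c ℓ} (R : CommutativeRing c ℓ) where

  open import Algebra.Bundles using (Ring)
  open import Algebra.Solver.Ring.AlmostCommutativeRing
    using (fromCommutativeRing; _-Raw-AlmostCommutative⟶_)
  open import Algebra.Properties.Ring (CommutativeRing.ring R)
    using (-‿distribˡ-*; -‿distribʳ-*; -‿involutive; -0#≈0#)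
  open import Algebra.Properties.AbelianGroup (CommutativeRing.+-abelianGroup R)
    using (⁻¹-∙-comm; xyx⁻¹≈y)
  open import Algebra.Properties.Semiring.Mult.TCOptimised (CommutativeRing.semiring R)
    using (×-homo-+; ×1-homo-*) renaming (_×_ to _×′_)
  open import Data.Integer as ℤ using (ℤ; +_; -[1+_]; _⊖_; _◃_; sign; ∣_∣)
  open import Data.Integer.Properties using (+-*-ring; [1+m]⊖[1+n]≡m⊖n)
  open import Data.Maybe using (Maybe; just; nothing)
  open import Data.Nat as ℕ using (zero; suc)
  import Data.Nat.Properties as ℕ
  open import Data.Sign as Sign using (Sign)
  open import Relation.Nullary using (yes; no)
  import Relation.Binary.PropositionalEquality as ≡

  open CommutativeRing R
  open import Relation.Binary.Reasoning.Setoid setoid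

  private
    -- The type-checking-optimised multiple _×′_ makes ⟦ + 2 ⟧ℤ and ⟦ + 4 ⟧ℤ reduce to 1# + 1#
    -- and to Defs.four, so solved identities state numerals exactly as the theorem does.
    ⟦_⟧ℤ : ℤ → Carrier
    ⟦ + n ⟧ℤ      = n ×′ 1#
    ⟦ -[1+ n ] ⟧ℤ = - (suc n ×′ 1#)

    signed : Sign → Carrier → Carrier
    signed Sign.+ x = x
    signed Sign.- x = - x

    signed-cong : ∀ s {x y} → x ≈ y → signed s x ≈ signed s y
    signed-cong Sign.+ x≈y = x≈y
    signed-cong Sign.- = -‿cong

    signed-* : ∀ s t x y → signed (s Sign.* t) (x * y) ≈ signed s x * signed t y
    signed-* Sign.+ Sign.+ x y = refl
    signed-* Sign.+ Sign.- x y = -‿distribʳ-* x y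
    signed-* Sign.- Sign.+ x y = -‿distribˡ-* x y
    signed-* Sign.- Sign.- x y = begin
      x * y           ≈⟨ -‿involutive (x * y) ⟨
      - - (x * y)     ≈⟨ -‿cong (-‿distribʳ-* x y) ⟩
      - (x * - y)     ≈⟨ -‿distribˡ-* x (- y) ⟩
      - x * - y       ∎

    ⟦◃⟧ : ∀ s n → ⟦ s ◃ n ⟧ℤ ≈ signed s (n ×′ 1#)
    ⟦◃⟧ Sign.+ zero    = refl
    ⟦◃⟧ Sign.- zero    = sym -0#≈0#
    ⟦◃⟧ Sign.+ (suc n) = refl
    ⟦◃⟧ Sign.- (suc n) = refl

    ⟦⟧-signed : ∀ i → ⟦ i ⟧ℤ ≈ signed (sign i) (∣ i ∣ ×′ 1#)
    ⟦⟧-signed (+ n)      = refl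
    ⟦⟧-signed -[1+ n ]   = refl

    ⟦⊖⟧ : ∀ m n → ⟦ m ⊖ n ⟧ℤ ≈ m ×′ 1# - n ×′ 1#
    ⟦⊖⟧ zero    zero    = sym (-‿inverseʳ 0#)
    ⟦⊖⟧ zero    (suc n) = sym (+-identityˡ _)
    ⟦⊖⟧ (suc m) zero    = sym (trans (+-congˡ -0#≈0#) (+-identityʳ _))
    ⟦⊖⟧ (suc m) (suc n) = begin
      ⟦ suc m ⊖ suc n ⟧ℤ            ≡⟨ ≡.cong ⟦_⟧ℤ ([1+m]⊖[1+n]≡m⊖n m n) ⟩
      ⟦ m ⊖ n ⟧ℤ                    ≈⟨ ⟦⊖⟧ m n ⟩
      a - b                         ≈⟨ +-congʳ (xyx⁻¹≈y 1# a) ⟨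
      ((1# + a) - 1#) - b           ≈⟨ +-assoc (1# + a) (- 1#) (- b) ⟩
      (1# + a) + (- 1# - b)         ≈⟨ +-cong (×-homo-+ 1# 1 m) (sym (⁻¹-∙-comm 1# b)) ⟨
      suc m ×′ 1# - (1# + b)        ≈⟨ +-congˡ (-‿cong (×-homo-+ 1# 1 n)) ⟨
      suc m ×′ 1# - suc n ×′ 1#     ∎
      where a = m ×′ 1#; b = n ×′ 1#

    ⟦+⟧ : ∀ i j → ⟦ i ℤ.+ j ⟧ℤ ≈ ⟦ i ⟧ℤ + ⟦ j ⟧ℤ
    ⟦+⟧ (+ m)    (+ n)    = ×-homo-+ 1# m n
    ⟦+⟧ (+ m)    -[1+ n ] = ⟦⊖⟧ m (suc n)
    ⟦+⟧ -[1+ m ] (+ n)    = trans (⟦⊖⟧ n (suc m)) (+-comm _ _)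
    ⟦+⟧ -[1+ m ] -[1+ n ] = begin
      - (suc (suc m ℕ.+ n) ×′ 1#)       ≡⟨ ≡.cong (λ k → - (k ×′ 1#)) (≡.sym (ℕ.+-suc (suc m) n)) ⟩
      - ((suc m ℕ.+ suc n) ×′ 1#)       ≈⟨ -‿cong (×-homo-+ 1# (suc m) (suc n)) ⟩
      - (suc m ×′ 1# + suc n ×′ 1#)     ≈⟨ ⁻¹-∙-comm _ _ ⟨
      - (suc m ×′ 1#) - (suc n ×′ 1#)   ∎

    ⟦*⟧ : ∀ i j → ⟦ i ℤ.* j ⟧ℤ ≈ ⟦ i ⟧ℤ * ⟦ j ⟧ℤ
    ⟦*⟧ i j = begin
      ⟦ s ◃ ∣ i ∣ ℕ.* ∣ j ∣ ⟧ℤ                  ≈⟨ ⟦◃⟧ s (∣ i ∣ ℕ.* ∣ j ∣) ⟩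
      signed s ((∣ i ∣ ℕ.* ∣ j ∣) ×′ 1#)        ≈⟨ signed-cong s (×1-homo-* ∣ i ∣ ∣ j ∣) ⟩
      signed s ((∣ i ∣ ×′ 1#) * (∣ j ∣ ×′ 1#))   ≈⟨ signed-* (sign i) (sign j) _ _ ⟩
      signed (sign i) (∣ i ∣ ×′ 1#) * signed (sign j) (∣ j ∣ ×′ 1#)
                                               ≈⟨ *-cong (⟦⟧-signed i) (⟦⟧-signed j) ⟨
      ⟦ i ⟧ℤ * ⟦ j ⟧ℤ                            ∎
      where s = sign i Sign.* sign j

    ⟦-⟧ : ∀ i → ⟦ ℤ.- i ⟧ℤ ≈ - ⟦ i ⟧ℤ
    ⟦-⟧ (+ zero)  = sym -0#≈0#
    ⟦-⟧ (+ suc n) = refl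
    ⟦-⟧ -[1+ n ]  = sym (-‿involutive _)

    homomorphism : Ring.rawRing +-*-ring -Raw-AlmostCommutative⟶ fromCommutativeRing R
    homomorphism = record
      { ⟦_⟧ = ⟦_⟧ℤ ; +-homo = ⟦+⟧ ; *-homo = ⟦*⟧ ; -‿homo = ⟦-⟧ ; 0-homo = refl ; 1-homo = refl }

    _≟ℤ_ : ∀ i j → Maybe (⟦ i ⟧ℤ ≈ ⟦ j ⟧ℤ)
    i ≟ℤ j with i ℤ.≟ j
    ... | yes ≡.refl = just refl
    ... | no _       = nothing

  open import Algebra.Solver.Ring _ _ homomorphism _≟ℤ_ public

module FieldProperties {c ℓ} (F : Field c ℓ) where

  open Field F hiding (zero)
  open import Data.Nat as ℕ using (zero; suc)
  open import Data.Nat.Divisibility using (_∣_; divides; ∣m∣n⇒∣m+n; ∣-refl)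
  open import Data.Fin using (Fin; zero; suc)
  open import Function using (_∘_)
  open import Relation.Nullary using (contradiction)
  import Relation.Binary.PropositionalEquality as ≡
  open import Algebra.Properties.Semiring.Mult semiring using (_×_; ×1-homo-*)
  open import Algebra.Properties.CommutativeMonoid.Sum *-commutativeMonoid using () renaming (sum to product)
  open import Relation.Binary.Reasoning.Setoid setoid
  open import Algebra.Properties.Ring ring using (x[y-z]≈xy-xz)
  open import Algebra.Properties.Group +-group using (x∙y⁻¹≈ε⇒x≈y; x≈y⇒x∙y⁻¹≈ε)

  x*y≈0⇒y≈0 : ∀ {x y} → ¬ x ≈ 0# → x * y ≈ 0# → y ≈ 0#
  x*y≈0⇒y≈0 {x} {y} x≉0 xy≈0 = begin
    y                  ≈⟨ *-identityˡ y ⟨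
    1# * y             ≈⟨ *-congʳ (⁻¹-inverse x x≉0) ⟨
    (x * x ⁻¹) * y     ≈⟨ *-congʳ (*-comm x (x ⁻¹)) ⟩
    (x ⁻¹ * x) * y     ≈⟨ *-assoc (x ⁻¹) x y ⟩
    x ⁻¹ * (x * y)     ≈⟨ *-congˡ xy≈0 ⟩
    x ⁻¹ * 0#          ≈⟨ zeroʳ (x ⁻¹) ⟩
    0#                 ∎

  x≉0∧y≉0⇒x*y≉0 : ∀ {x y} → ¬ x ≈ 0# → ¬ y ≈ 0# → ¬ x * y ≈ 0#
  x≉0∧y≉0⇒x*y≉0 x≉0 y≉0 xy≈0 = y≉0 (x*y≈0⇒y≈0 x≉0 xy≈0)

  *-cancelˡ-≉0 : ∀ {x y z} → ¬ x ≈ 0# → x * y ≈ x * z → y ≈ z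
  *-cancelˡ-≉0 {x} {y} {z} x≉0 xy≈xz =
    x∙y⁻¹≈ε⇒x≈y y z (x*y≈0⇒y≈0 x≉0 (trans (x[y-z]≈xy-xz x y z) (x≈y⇒x∙y⁻¹≈ε xy≈xz)))

  product≉0 : ∀ {m} (v : Fin m → Carrier) → (∀ i → ¬ v i ≈ 0#) → ¬ product v ≈ 0#
  product≉0 {zero}  v vᵢ≉0 = 1≉0
  product≉0 {suc m} v vᵢ≉0 = x≉0∧y≉0⇒x*y≉0 (vᵢ≉0 zero) (product≉0 (v ∘ suc) (vᵢ≉0 ∘ suc))

  ×1≉0⇒^×1≉0 : ∀ {m} j → ¬ m × 1# ≈ 0# → ¬ (m ℕ.^ j) × 1# ≈ 0#
  ×1≉0⇒^×1≉0     zero    m×1≉0 = 1≉0 ∘ trans (sym (+-identityʳ 1#))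
  ×1≉0⇒^×1≉0 {m} (suc j) m×1≉0 =
    x≉0∧y≉0⇒x*y≉0 m×1≉0 (×1≉0⇒^×1≉0 j m×1≉0) ∘ trans (sym (×1-homo-* m (m ℕ.^ j)))

  1+1≈0⇒odd×1≈1 : ∀ {m} → ¬ 2 ∣ m → 1# + 1# ≈ 0# → m × 1# ≈ 1#
  1+1≈0⇒odd×1≈1 {zero}        2∤m 1+1≈0 = contradiction (divides 0 ≡.refl) 2∤m
  1+1≈0⇒odd×1≈1 {suc zero}    2∤m 1+1≈0 = +-identityʳ 1#
  1+1≈0⇒odd×1≈1 {suc (suc m)} 2∤m 1+1≈0 = begin
    1# + (1# + m × 1#)     ≈⟨ +-assoc 1# 1# _ ⟨
    (1# + 1#) + m × 1#     ≈⟨ +-congʳ 1+1≈0 ⟩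
    0# + m × 1#            ≈⟨ +-identityˡ _ ⟩
    m × 1#                 ≈⟨ 1+1≈0⇒odd×1≈1 (2∤m ∘ ∣m∣n⇒∣m+n (∣-refl {2})) 1+1≈0 ⟩
    1#                     ∎

  inverse-unique : ∀ {x y z} → x * y ≈ 1# → x * z ≈ 1# → y ≈ z
  inverse-unique {x} {y} {z} xy≈1 xz≈1 = begin
    y                  ≈⟨ *-identityʳ y ⟨
    y * 1#             ≈⟨ *-congˡ xz≈1 ⟨
    y * (x * z)        ≈⟨ *-assoc y x z ⟨
    (y * x) * z        ≈⟨ *-congʳ (trans (*-comm y x) xy≈1) ⟩
    1# * z             ≈⟨ *-identityˡ z ⟩
    z                  ∎

module HornerPolynomials {c ℓ} (F : Field c ℓ) where

  open Field F hiding (zero)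
  open FieldProperties F
  open IntegerCoefficients commutativeRing using (solve; _:=_; _:+_; _:*_; _:-_)
  open import Relation.Binary.Reasoning.Setoid setoid
  open import Algebra.Properties.Group +-group using (x∙y⁻¹≈ε⇒x≈y)
  open import Data.List using (List; []; _∷_; length; map)
  open import Data.List.Properties using (length-map)
  open import Data.Nat as ℕ using (zero; suc; _≤_; _<_; z≤n; s≤s)
  import Data.Nat.Properties as ℕ
  open import Data.Fin using (Fin; zero; suc)
  import Data.Fin.Properties as Fin
  open import Data.Fin.Properties using (0≢1+n)
  open import Algebra.Properties.Ring ring using (-0#≈0#)
  open import Data.Empty using (⊥-elim)
  open import Function using (_∘_)
  import Relation.Binary.PropositionalEquality as ≡

  eval : List Carrier → Carrier → Carrier
  eval []       x = 0#
  eval (a ∷ as) x = a + x * eval as x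

  infixl 6 _⊕_
  _⊕_ : List Carrier → List Carrier → List Carrier
  []       ⊕ bs       = bs
  (a ∷ as) ⊕ []       = a ∷ as
  (a ∷ as) ⊕ (b ∷ bs) = (a + b) ∷ (as ⊕ bs)

  eval-⊕ : ∀ as bs x → eval (as ⊕ bs) x ≈ eval as x + eval bs x
  eval-⊕ []       bs       x = sym (+-identityˡ _)
  eval-⊕ (a ∷ as) []       x = sym (+-identityʳ _)
  eval-⊕ (a ∷ as) (b ∷ bs) x = begin
    (a + b) + x * eval (as ⊕ bs) x           ≈⟨ +-congˡ (*-congˡ (eval-⊕ as bs x)) ⟩
    (a + b) + x * (eval as x + eval bs x)
      ≈⟨ solve 5 (λ a b x u v → (a :+ b) :+ x :* (u :+ v) := (a :+ x :* u) :+ (b :+ x :* v))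
                 refl a b x (eval as x) (eval bs x) ⟩
    (a + x * eval as x) + (b + x * eval bs x) ∎

  length-⊕ : ∀ as bs → length bs ≤ length as → length (as ⊕ bs) ≡.≡ length as
  length-⊕ []       []       _         = ≡.refl
  length-⊕ (a ∷ as) []       _         = ≡.refl
  length-⊕ (a ∷ as) (b ∷ bs) (s≤s b≤a) = ≡.cong suc (length-⊕ as bs b≤a)

  eval-scale : ∀ a bs x → eval (map (a *_) bs) x ≈ a * eval bs x
  eval-scale a []       x = sym (zeroʳ a)
  eval-scale a (b ∷ bs) x = begin
    a * b + x * eval (map (a *_) bs) x       ≈⟨ +-congˡ (*-congˡ (eval-scale a bs x)) ⟩
    a * b + x * (a * eval bs x)
      ≈⟨ solve 4 (λ a b x u → a :* b :+ x :* (a :* u) := a :* (b :+ x :* u)) refl a b x (eval bs x) ⟩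
    a * (b + x * eval bs x)                  ∎

  monomial : ℕ → List Carrier
  monomial zero    = 1# ∷ []
  monomial (suc j) = 0# ∷ monomial j

  eval-monomial : ∀ j x → eval (monomial j) x ≈ x ^ j
  eval-monomial zero    x = trans (+-congˡ (zeroʳ x)) (+-identityʳ 1#)
  eval-monomial (suc j) x = trans (+-identityˡ _) (*-congˡ (eval-monomial j x))

  length-monomial : ∀ j → length (monomial j) ≡.≡ suc j
  length-monomial zero    = ≡.refl
  length-monomial (suc j) = ≡.cong suc (length-monomial j)

  quotient : Carrier → List Carrier → List Carrier
  quotient a []       = []
  quotient a (b ∷ bs) = bs ⊕ map (a *_) (quotient a bs)

  length-quotient : ∀ a b bs → length (quotient a (b ∷ bs)) ≡.≡ length bs
  length-quotient a b []        = ≡.refl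
  length-quotient a b (b′ ∷ bs) = length-⊕ (b′ ∷ bs) (map (a *_) (quotient a (b′ ∷ bs)))
    (ℕ.m≤n⇒m≤1+n (ℕ.≤-reflexive
      (≡.trans (length-map (a *_) (quotient a (b′ ∷ bs))) (length-quotient a b′ bs))))

  eval-quotient : ∀ a bs x → eval bs x - eval bs a ≈ (x - a) * eval (quotient a bs) x
  eval-quotient a []       x = trans (-‿inverseʳ 0#) (sym (zeroʳ _))
  eval-quotient a (b ∷ bs) x = begin
    (b + x * u) - (b + a * v)
      ≈⟨ solve 5 (λ a b x u v → (b :+ x :* u) :- (b :+ a :* v) := (x :- a) :* u :+ a :* (u :- v))
                 refl a b x u v ⟩
    (x - a) * u + a * (u - v)                ≈⟨ +-congˡ (*-congˡ (eval-quotient a bs x)) ⟩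
    (x - a) * u + a * ((x - a) * w)
      ≈⟨ solve 4 (λ d a u w → d :* u :+ a :* (d :* w) := d :* (u :+ a :* w)) refl (x - a) a u w ⟩
    (x - a) * (u + a * w)                    ≈⟨ *-congˡ (+-congˡ (eval-scale a (quotient a bs) x)) ⟨
    (x - a) * (u + eval (map (a *_) (quotient a bs)) x) ≈⟨ *-congˡ (eval-⊕ bs _ x) ⟨
    (x - a) * eval (quotient a (b ∷ bs)) x   ∎
    where
    u = eval bs x
    v = eval bs a
    w = eval (quotient a bs) x

  roots<length : ∀ m (r : Fin m → Carrier) bs {x₀} → (∀ {i j} → r i ≈ r j → i ≡.≡ j) →
                 (∀ i → eval bs (r i) ≈ 0#) → ¬ eval bs x₀ ≈ 0# → m < length bs
  roots<length m       r []       r-inj roots bs[x₀]≉0 = ⊥-elim (bs[x₀]≉0 refl)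
  roots<length zero    r (_ ∷ _)  r-inj roots bs[x₀]≉0 = s≤s z≤n
  roots<length (suc m) r (b ∷ bs) {x₀} r-inj roots bs[x₀]≉0 =
    s≤s (≡.subst (m <_) (length-quotient a b bs)
      (roots<length m (r ∘ suc) qs (Fin.suc-injective ∘ r-inj) qs-roots qs[x₀]≉0))
    where
    a  = r zero
    qs = quotient a (b ∷ bs)
    factor : ∀ x → eval (b ∷ bs) x ≈ (x - a) * eval qs x
    factor x = begin
      eval (b ∷ bs) x                          ≈⟨ +-identityʳ _ ⟨
      eval (b ∷ bs) x + 0#                     ≈⟨ +-congˡ (trans (-‿cong (roots zero)) -0#≈0#) ⟨
      eval (b ∷ bs) x - eval (b ∷ bs) a        ≈⟨ eval-quotient a (b ∷ bs) x ⟩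
      (x - a) * eval qs x                      ∎
    qs-roots : ∀ i → eval qs (r (suc i)) ≈ 0#
    qs-roots i = x*y≈0⇒y≈0 rᵢ₊₁-a≉0 (trans (sym (factor (r (suc i)))) (roots (suc i)))
      where
      rᵢ₊₁-a≉0 : ¬ r (suc i) - a ≈ 0#
      rᵢ₊₁-a≉0 = 0≢1+n ∘ ≡.sym ∘ r-inj ∘ x∙y⁻¹≈ε⇒x≈y _ _
    qs[x₀]≉0 : ¬ eval qs x₀ ≈ 0#
    qs[x₀]≉0 qs[x₀]≈0 = bs[x₀]≉0 (trans (factor x₀) (trans (*-congˡ qs[x₀]≈0) (zeroʳ _)))

module FinPermutations where

  open import Data.Nat using (suc)
  open import Data.Fin using (Fin; punchOut)
  open import Data.Fin.Properties using (any?; _≟_; punchOut-injective; injective⇒≤)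
  open import Data.Fin.Permutation using (Permutation; permutation)
  open import Data.Nat.Properties using (1+n≰n)
  open import Data.Product using (_,_; proj₁; proj₂)
  open import Function.Definitions using (Injective; Surjective)
  open import Relation.Nullary using (yes; no; contradiction)
  open import Relation.Binary.PropositionalEquality using (_≡_; refl; sym)

  injective⇒surjective : ∀ {n} {g : Fin n → Fin n} → Injective _≡_ _≡_ g → Surjective _≡_ _≡_ g
  injective⇒surjective {suc n} {g} g-inj y with any? (λ x → g x ≟ y)
  ... | yes (x , gx≡y) = x , λ { refl → gx≡y }
  ... | no ∄x          = contradiction (injective⇒≤ h-inj) 1+n≰n
    where
    h : Fin (suc n) → Fin n
    h x = punchOut {i = y} {j = g x} (λ y≡gx → ∄x (x , sym y≡gx))
    h-inj : Injective _≡_ _≡_ h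
    h-inj {x} {x′} hx≡hx′ = g-inj (punchOut-injective {i = y} {j = g x} {k = g x′} _ _ hx≡hx′)

  injective⇒permutation : ∀ {n} {g : Fin n → Fin n} → Injective _≡_ _≡_ g → Permutation n n
  injective⇒permutation {n} {g} g-inj = permutation g g⁻¹ g∘g⁻¹ (λ x → g-inj (g∘g⁻¹ (g x)))
    where
    g⁻¹ : Fin n → Fin n
    g⁻¹ y = proj₁ (injective⇒surjective g-inj y)
    g∘g⁻¹ : ∀ y → g (g⁻¹ y) ≡ y
    g∘g⁻¹ y = proj₂ (injective⇒surjective g-inj y) refl

module CommutativeMonoidSums {a ℓ} (M : CommutativeMonoid a ℓ) where

  open import Data.Fin using (Fin)
  open import Function.Definitions using (Injective)
  open import Relation.Binary.PropositionalEquality using (_≡_)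
  open CommutativeMonoid M
  open import Algebra.Properties.CommutativeMonoid.Sum M using (sum; sum-permute; sum-cong-≋; ∑-distrib-+; sum-replicate)
  open import Algebra.Definitions.RawMonoid rawMonoid using (_×_)
  open import Relation.Binary.Reasoning.Setoid setoid
  open FinPermutations using (injective⇒permutation)

  ×∙sum≈sum : ∀ {m} (v : Fin m → Carrier) c {φ : Fin m → Fin m} → Injective _≡_ _≡_ φ →
              (∀ i → v (φ i) ≈ c ∙ v i) → (m × c) ∙ sum v ≈ sum v
  ×∙sum≈sum {m} v c {φ} φ-inj v∘φ≈c∙v = begin
    (m × c) ∙ sum v             ≈⟨ ∙-congʳ (sum-replicate m {c}) ⟨
    sum {m} (λ _ → c) ∙ sum v   ≈⟨ ∑-distrib-+ {m} (λ _ → c) v ⟨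
    sum (λ i → c ∙ v i)         ≈⟨ sum-cong-≋ (λ i → sym (v∘φ≈c∙v i)) ⟩
    sum (λ i → v (φ i))         ≈⟨ sum-permute v (injective⇒permutation φ-inj) ⟨
    sum v                       ∎

module FiniteField {c ℓ} (F : Field c ℓ) {n : ℕ} (card : HasCardinality F (ℕ.suc n)) where

  open Field F hiding (zero)
  open FieldProperties F
  open import Data.Nat as ℕ using (suc)
  open import Data.Fin using (Fin; punchIn; punchOut)
  open import Data.Fin.Properties as Fin using (punchInᵢ≢i; punchIn-punchOut; punchIn-injective)
  open import Data.Product using (_,_)
  open import Function using (_∘_)
  open import Function.Definitions using (Congruent; Injective; Surjective)
  open import Function.Properties.Bijection using (Bijection⇒Inverse)
  open import Function.Bundles using (Inverse)
  open import Relation.Binary.Definitions using (Decidable)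
  open import Relation.Nullary using (yes; no)
  open import Relation.Nullary.Decidable using (decidable-stable; map′)
  import Relation.Binary.PropositionalEquality as ≡
  open import Relation.Binary.Reasoning.Setoid setoid
  open import Algebra.Properties.Semiring.Mult semiring using (_×_)
  open import Algebra.Properties.CommutativeMonoid.Sum *-commutativeMonoid using () renaming (sum to product)
  open import Algebra.Properties.Group +-group using (identityˡ-unique) renaming (∙-cancelˡ to +-cancelˡ)
  open FinPermutations using (injective⇒surjective)
  open Inverse (Bijection⇒Inverse card)
    renaming (to to index; from to element; to-cong to index-cong)
    using (strictlyInverseˡ; strictlyInverseʳ)

  element-injective : ∀ {i j} → element i ≈ element j → i ≡.≡ j
  element-injective {i} {j} eᵢ≈eⱼ =
    ≡.trans (≡.sym (strictlyInverseˡ i)) (≡.trans (index-cong eᵢ≈eⱼ) (strictlyInverseˡ j))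

  index-injective : ∀ {x y} → index x ≡.≡ index y → x ≈ y
  index-injective {x} {y} iₓ≡iᵧ =
    trans (sym (strictlyInverseʳ x)) (trans (reflexive (≡.cong element iₓ≡iᵧ)) (strictlyInverseʳ y))

  _≟_ : Decidable _≈_
  x ≟ y = map′ index-injective index-cong (index x Fin.≟ index y)

  ≈-stable : ∀ {x y} → ¬ ¬ x ≈ y → x ≈ y
  ≈-stable {x} {y} = decidable-stable (x ≟ y)

  injective⇒bijective : ∀ {f : Carrier → Carrier} →
                        Congruent _≈_ _≈_ f → Injective _≈_ _≈_ f → IsPermutation f
  injective⇒bijective {f} f-cong f-inj = f-inj , f-surj
    where
    g : Fin (suc n) → Fin (suc n)
    g i = index (f (element i))
    f-surj : Surjective _≈_ _≈_ f
    f-surj y with injective⇒surjective (element-injective ∘ f-inj ∘ index-injective) (index y)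
    ... | i , gᵢ≡iᵧ = element i , λ x≈eᵢ → trans (f-cong x≈eᵢ) (index-injective (gᵢ≡iᵧ ≡.refl))

  suc-n×x≈0 : ∀ x → suc n × x ≈ 0#
  suc-n×x≈0 x =
    identityˡ-unique _ _ (×∙sum≈sum element x shift-injective (λ i → strictlyInverseʳ (x + element i)))
    where
    open CommutativeMonoidSums +-commutativeMonoid using (×∙sum≈sum)
    shift : Fin (suc n) → Fin (suc n)
    shift i = index (x + element i)
    shift-injective : Injective ≡._≡_ ≡._≡_ shift
    shift-injective sᵢ≡sⱼ = element-injective (+-cancelˡ x _ _ (index-injective sᵢ≡sⱼ))

  card≡p^m⇒p×1≈0 : ∀ {p m} → suc n ≡.≡ p ℕ.^ m → p × 1# ≈ 0#
  card≡p^m⇒p×1≈0 {p} {m} card≡p^m = ≈-stable λ p×1≉0 →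
    ×1≉0⇒^×1≉0 m p×1≉0 (trans (reflexive (≡.cong (_× 1#) (≡.sym card≡p^m))) (suc-n×x≈0 1#))

  unit : Fin n → Carrier
  unit i = element (punchIn (index 0#) i)

  unit-≉0 : ∀ i → ¬ unit i ≈ 0#
  unit-≉0 i uᵢ≈0 = punchInᵢ≢i (index 0#) i (≡.trans (≡.sym (strictlyInverseˡ _)) (index-cong uᵢ≈0))

  unit-injective : ∀ {i j} → unit i ≈ unit j → i ≡.≡ j
  unit-injective uᵢ≈uⱼ = punchIn-injective (index 0#) _ _ (element-injective uᵢ≈uⱼ)

  unit-index : ∀ x → ¬ x ≈ 0# → Fin n
  unit-index x x≉0 = punchOut {i = index 0#} {j = index x} (λ i₀≡iₓ → x≉0 (sym (index-injective i₀≡iₓ)))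

  unit∘unit-index : ∀ x (x≉0 : ¬ x ≈ 0#) → unit (unit-index x x≉0) ≈ x
  unit∘unit-index x x≉0 = trans (reflexive (≡.cong element (punchIn-punchOut _))) (strictlyInverseʳ x)

  x≉0⇒x^n≈1 : ∀ {x} → ¬ x ≈ 0# → x ^ n ≈ 1#
  x≉0⇒x^n≈1 {x} x≉0 = *-cancelˡ-≉0 (product≉0 unit unit-≉0) (begin
    product unit * x ^ n       ≈⟨ *-comm _ _ ⟩
    x ^ n * product unit       ≈⟨ ×∙sum≈sum unit x scale-injective (λ i → unit∘unit-index _ (x*u≉0 i)) ⟩
    product unit               ≈⟨ *-identityʳ _ ⟨
    product unit * 1#          ∎)
    where
    open CommutativeMonoidSums *-commutativeMonoid using (×∙sum≈sum)
    x*u≉0 : ∀ i → ¬ x * unit i ≈ 0#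
    x*u≉0 i = x≉0∧y≉0⇒x*y≉0 x≉0 (unit-≉0 i)
    scale : Fin n → Fin n
    scale i = unit-index (x * unit i) (x*u≉0 i)
    scale-injective : Injective ≡._≡_ ≡._≡_ scale
    scale-injective {i} {j} sᵢ≡sⱼ = unit-injective (*-cancelˡ-≉0 x≉0 (begin
      x * unit i               ≈⟨ unit∘unit-index _ (x*u≉0 i) ⟨
      unit (scale i)           ≡⟨ ≡.cong unit sᵢ≡sⱼ ⟩
      unit (scale j)           ≈⟨ unit∘unit-index _ (x*u≉0 j) ⟩
      x * unit j               ∎))

  x^[1+n]≈x : ∀ x → x ^ suc n ≈ x
  x^[1+n]≈x x with x ≟ 0#
  ... | yes x≈0 = trans (*-congʳ x≈0) (trans (zeroˡ _) (sym x≈0))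
  ... | no  x≉0 = trans (*-congˡ (x≉0⇒x^n≈1 x≉0)) (*-identityʳ x)

module BinomialDivisibility where

  open import Data.Nat using (zero; suc; _+_; _*_; _<_; z<s)
  open import Data.Nat.Properties using (*-zeroʳ; *-identityˡ; *-identityʳ; <⇒≱)
  open import Data.Nat.Combinatorics using (_C_; nC1≡n; nCk+nC[k+1]≡[n+1]C[k+1])
  open import Data.Nat.Divisibility using (_∣_; m∣m*n; ∣⇒≤)
  open import Data.Nat.Primality using (Prime; euclidsLemma)
  open import Data.Nat.Solver using (module +-*-Solver)
  open import Data.Sum using (inj₁; inj₂)
  open import Relation.Nullary using (contradiction)
  open import Relation.Binary.PropositionalEquality
    using (_≡_; refl; sym; trans; cong; cong₂; subst; module ≡-Reasoning)
  open +-*-Solver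

  [1+k]*[1+n]C[1+k]≡[1+n]*nCk : ∀ n k → suc k * (suc n C suc k) ≡ suc n * (n C k)
  [1+k]*[1+n]C[1+k]≡[1+n]*nCk zero    zero    = refl
  [1+k]*[1+n]C[1+k]≡[1+n]*nCk zero    (suc k) = *-zeroʳ (suc (suc k))
  [1+k]*[1+n]C[1+k]≡[1+n]*nCk (suc n) zero    =
    trans (*-identityˡ _) (trans (nC1≡n (suc (suc n))) (sym (*-identityʳ _)))
  [1+k]*[1+n]C[1+k]≡[1+n]*nCk (suc n) (suc k) = begin
    (2 + k) * ((2 + n) C (2 + k))            ≡⟨ cong ((2 + k) *_) (nCk+nC[k+1]≡[n+1]C[k+1] (suc n) (suc k)) ⟨
    (2 + k) * (A + B)
      ≡⟨ solve 3 (λ k a b → (con 2 :+ k) :* (a :+ b) := (con 1 :+ k) :* a :+ a :+ (con 2 :+ k) :* b) refl k A B ⟩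
    (1 + k) * A + A + (2 + k) * B
      ≡⟨ cong₂ (λ u v → u + A + v) ([1+k]*[1+n]C[1+k]≡[1+n]*nCk n k) ([1+k]*[1+n]C[1+k]≡[1+n]*nCk n (suc k)) ⟩
    (1 + n) * (n C k) + A + (1 + n) * (n C suc k)
      ≡⟨ solve 4 (λ n a c d → (con 1 :+ n) :* c :+ a :+ (con 1 :+ n) :* d := (con 1 :+ n) :* (c :+ d) :+ a)
                 refl n A (n C k) (n C suc k) ⟩
    (1 + n) * ((n C k) + (n C suc k)) + A    ≡⟨ cong (λ u → (1 + n) * u + A) (nCk+nC[k+1]≡[n+1]C[k+1] n k) ⟩
    (1 + n) * A + A                          ≡⟨ solve 2 (λ n a → (con 1 :+ n) :* a :+ a := (con 2 :+ n) :* a) refl n A ⟩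
    (2 + n) * A                              ∎
    where
    open ≡-Reasoning
    A = suc n C suc k
    B = suc n C suc (suc k)

  p∣pCk : ∀ {p k} → Prime p → 0 < k → k < p → p ∣ p C k
  p∣pCk {suc p} {suc k} p-prime z<s k<p
    with euclidsLemma (suc k) (suc p C suc k) p-prime
           (subst (suc p ∣_) (sym ([1+k]*[1+n]C[1+k]≡[1+n]*nCk p k)) (m∣m*n (p C k)))
  ... | inj₂ p∣pCk = p∣pCk
  ... | inj₁ p∣k   = contradiction (∣⇒≤ p∣k) (<⇒≱ k<p)

module Frobenius {a ℓ} (S : CommutativeSemiring a ℓ) where

  open CommutativeSemiring S hiding (zero)
  open import Data.Nat as ℕ using (zero; suc; _<_; z<s; s<s; >-nonZero⁻¹)
  open import Data.Nat.Properties using (n∸n≡0)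
  open import Data.Nat.Combinatorics using (_C_; nCn≡1)
  open import Data.Nat.Divisibility using (divides)
  open import Data.Nat.Primality using (Prime; prime⇒nonZero)
  open import Data.Fin using (zero; suc; fromℕ)
  open import Data.Fin.Properties using (toℕ-fromℕ; inject₁ℕ<)
  open import Data.Vec.Functional using (init)
  open import Relation.Binary.PropositionalEquality as ≡ using (_≡_)
  open import Relation.Binary.Reasoning.Setoid setoid
  open import Algebra.Properties.Semiring.Mult semiring using (_×_; ×-homo-1; ×1-homo-*; ×-assoc-*; ×-congʳ)
  open import Algebra.Properties.Semiring.Exp semiring using (_^_; ^-assocʳ; ^-congˡ)
  open import Algebra.Properties.CommutativeSemiring.Binomial S using (theorem; binomialTerm)
  open import Algebra.Properties.Monoid.Sum +-monoid using (sum; sum-init-last; sum-cong-≋; sum-replicate-zero)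
  open BinomialDivisibility using (p∣pCk)

  freshmans-dream : ∀ n → 0 < n → (∀ k → 0 < k → k < n → ∀ z → (n C k) × z ≈ 0#) →
                    ∀ x y → (x + y) ^ n ≈ x ^ n + y ^ n
  freshmans-dream (suc n) z<s middle≈0 x y = begin
    (x + y) ^ suc n                                      ≈⟨ theorem (suc n) x y ⟩
    t zero + sum (λ i → t (suc i))                       ≈⟨ +-congˡ (sum-init-last (λ i → t (suc i))) ⟩
    t zero + (sum (init (λ i → t (suc i))) + t (suc (fromℕ n)))
                                                         ≈⟨ +-cong first≈ (+-cong inner≈0 last≈) ⟩
    y ^ suc n + (0# + x ^ suc n)                         ≈⟨ +-comm _ _ ⟩
    (0# + x ^ suc n) + y ^ suc n                         ≈⟨ +-congʳ (+-identityˡ _) ⟩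
    x ^ suc n + y ^ suc n                                ∎
    where
    t = binomialTerm x y (suc n)
    first≈ : t zero ≈ y ^ suc n
    first≈ = trans (×-homo-1 _) (*-identityˡ _)
    inner≈0 : sum (init (λ i → t (suc i))) ≈ 0#
    inner≈0 = trans (sum-cong-≋ {n} (λ i → middle≈0 _ z<s (s<s (inject₁ℕ< i)) _)) (sum-replicate-zero n)
    last≈ : t (suc (fromℕ n)) ≈ x ^ suc n
    last≈ = begin
      t (suc (fromℕ n))
        ≡⟨ ≡.cong (λ k → (suc n C suc k) × (x ^ suc k * y ^ (n ℕ.∸ k))) (toℕ-fromℕ n) ⟩
      (suc n C suc n) × (x ^ suc n * y ^ (n ℕ.∸ n))
        ≡⟨ ≡.cong₂ (λ c e → c × (x ^ suc n * y ^ e)) (nCn≡1 (suc n)) (n∸n≡0 n) ⟩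
      1 × (x ^ suc n * 1#)             ≈⟨ ×-homo-1 _ ⟩
      x ^ suc n * 1#                   ≈⟨ *-identityʳ _ ⟩
      x ^ suc n                        ∎

  module _ {p} (p-prime : Prime p) (p×1≈0 : p × 1# ≈ 0#) where

    [d*p]×x≈0 : ∀ d x → (d ℕ.* p) × x ≈ 0#
    [d*p]×x≈0 d x = begin
      (d ℕ.* p) × x                      ≈⟨ ×-congʳ (d ℕ.* p) (*-identityˡ x) ⟨
      (d ℕ.* p) × (1# * x)               ≈⟨ ×-assoc-* (d ℕ.* p) 1# x ⟨
      ((d ℕ.* p) × 1#) * x               ≈⟨ *-congʳ (×1-homo-* d p) ⟩
      ((d × 1#) * (p × 1#)) * x          ≈⟨ *-congʳ (*-congˡ p×1≈0) ⟩
      ((d × 1#) * 0#) * x                ≈⟨ *-congʳ (zeroʳ _) ⟩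
      0# * x                             ≈⟨ zeroˡ x ⟩
      0#                                 ∎

    frobenius-+ : ∀ x y → (x + y) ^ p ≈ x ^ p + y ^ p
    frobenius-+ = freshmans-dream p (>-nonZero⁻¹ p {{prime⇒nonZero p-prime}}) pCk×z≈0
      where
      pCk×z≈0 : ∀ k → 0 < k → k < p → ∀ z → (p C k) × z ≈ 0#
      pCk×z≈0 k 0<k k<p z with p∣pCk p-prime 0<k k<p
      ... | divides d pCk≡d*p = trans (reflexive (≡.cong (_× z) pCk≡d*p)) ([d*p]×x≈0 d z)

    frobenius-^-+ : ∀ j x y → (x + y) ^ (p ℕ.^ j) ≈ x ^ (p ℕ.^ j) + y ^ (p ℕ.^ j)
    frobenius-^-+ zero    x y = trans (*-identityʳ _) (sym (+-cong (*-identityʳ x) (*-identityʳ y)))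
    frobenius-^-+ (suc j) x y = begin
      (x + y) ^ (p ℕ.* p ℕ.^ j)                      ≈⟨ ^-assocʳ (x + y) p (p ℕ.^ j) ⟨
      ((x + y) ^ p) ^ (p ℕ.^ j)                      ≈⟨ ^-congˡ (p ℕ.^ j) (frobenius-+ x y) ⟩
      (x ^ p + y ^ p) ^ (p ℕ.^ j)                    ≈⟨ frobenius-^-+ j (x ^ p) (y ^ p) ⟩
      (x ^ p) ^ (p ℕ.^ j) + (y ^ p) ^ (p ℕ.^ j)
        ≈⟨ +-cong (^-assocʳ x p (p ℕ.^ j)) (^-assocʳ y p (p ℕ.^ j)) ⟩
      x ^ (p ℕ.* p ℕ.^ j) + y ^ (p ℕ.* p ℕ.^ j)      ∎

-- q is taken in the form 2 + r so that the cardinality q * q is visibly a successor.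
module QuadraticExtension {c ℓ} (F : Field c ℓ) {p k : ℕ} (p-prime : Prime p) (p-odd : Odd p) (r : ℕ)
                          (q≡p^[1+k] : ℕ.suc (ℕ.suc r) ≡ p ^ℕ ℕ.suc k)
                          (card : HasCardinality F (ℕ.suc (ℕ.suc r) *ℕ ℕ.suc (ℕ.suc r))) where

  open Field F hiding (zero)
  open FieldProperties F
  open FiniteField F card
  open Frobenius commutativeSemiring using (frobenius-^-+)
  open IntegerCoefficients commutativeRing using (solve; _:=_; _:+_; _:*_; _:-_; :-_; _:^_; con)
  open import Algebra.Properties.Group +-group
    using (x∙y⁻¹≈ε⇒x≈y; x≈y⇒x∙y⁻¹≈ε; identityʳ-unique; inverseʳ-unique)
    renaming (∙-cancelˡ to +-cancelˡ; ∙-cancelʳ to +-cancelʳ)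
  open import Algebra.Properties.Ring ring using (-‿involutive; -0#≈0#; x[y-z]≈xy-xz)
  open import Algebra.Properties.Semiring.Mult semiring using () renaming (_×_ to _×ₙ_)
  open import Algebra.Properties.Monoid.Mult *-monoid using (×-idem)
  open import Algebra.Properties.Semiring.Exp semiring using (^-congˡ; ^-assocʳ)
  open import Algebra.Properties.CommutativeSemiring.Exp commutativeSemiring using (^-distrib-*)
  open import Data.Integer using (+_)
  open import Data.Nat as ℕ using (suc; _≤_)
  import Data.Nat.Properties as ℕ
  open import Data.Fin using (Fin; inject≤)
  open import Data.Fin.Properties using (inject≤-injective)
  open import Data.List using (List; _∷_)
  open import Data.Product using (_×_; _,_; proj₁)
  open import Function using (_∘_)
  open import Function.Bundles using (mk⇔)
  open import Function.Definitions using (Injective)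
  open import Relation.Binary.PropositionalEquality as ≡ using (_≡_)
  open import Relation.Binary.Reasoning.Setoid setoid

  q : ℕ
  q = suc (suc r)

  σ : Carrier → Carrier
  σ x = x ^ q

  p×1≈0 : p ×ₙ 1# ≈ 0#
  p×1≈0 = card≡p^m⇒p×1≈0 {p} {suc k ℕ.+ suc k}
    (≡.trans (≡.cong (λ m → m ℕ.* m) q≡p^[1+k]) (≡.sym (ℕ.^-distribˡ-+-* p (suc k) (suc k))))

  σ-cong : ∀ {x y} → x ≈ y → σ x ≈ σ y
  σ-cong = ^-congˡ q

  σ-+ : ∀ x y → σ (x + y) ≈ σ x + σ y
  σ-+ x y = ≡.subst (λ m → (x + y) ^ m ≈ x ^ m + y ^ m) (≡.sym q≡p^[1+k])
                    (frobenius-^-+ p-prime p×1≈0 (suc k) x y)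

  σ-* : ∀ x y → σ (x * y) ≈ σ x * σ y
  σ-* x y = ^-distrib-* x y q

  σ-0 : σ 0# ≈ 0#
  σ-0 = zeroˡ _

  σ-1 : σ 1# ≈ 1#
  σ-1 = ×-idem (*-identityʳ 1#) q

  σ-‿ : ∀ x → σ (- x) ≈ - σ x
  σ-‿ x = inverseʳ-unique (σ x) (σ (- x)) (trans (sym (σ-+ x (- x))) (trans (σ-cong (-‿inverseʳ x)) σ-0))

  σ-involutive : ∀ x → σ (σ x) ≈ x
  σ-involutive x = trans (^-assocʳ x q q) (x^[1+n]≈x x)

  σ-Tr : ∀ x → σ (Tr q x) ≈ Tr q x
  σ-Tr x = trans (σ-+ x (σ x)) (trans (+-congˡ (σ-involutive x)) (+-comm _ _))

  σ-not-identity : ¬ (∀ x → InSubfield q x)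
  σ-not-identity σ≈id = ℕ.<-irrefl (≡.sym (≡.cong suc (length-monomial r)))
    (roots<length q root Xq⁻¹-1 root-injective root-is-root Xq⁻¹-1[0]≉0)
    where
    open HornerPolynomials F
    Xq⁻¹-1 : List Carrier
    Xq⁻¹-1 = - 1# ∷ monomial r
    q≤n : q ≤ suc r ℕ.+ suc r ℕ.* q
    q≤n = ℕ.≤-trans (ℕ.m≤n*m q (suc r)) (ℕ.m≤n+m (suc r ℕ.* q) (suc r))
    root : Fin q → Carrier
    root i = unit (inject≤ i q≤n)
    root-injective : ∀ {i j} → root i ≈ root j → i ≡ j
    root-injective rᵢ≈rⱼ = inject≤-injective q≤n q≤n _ _ (unit-injective rᵢ≈rⱼ)
    root-is-root : ∀ i → eval Xq⁻¹-1 (root i) ≈ 0#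
    root-is-root i = begin
      - 1# + u * eval (monomial r) u         ≈⟨ +-congˡ (*-congˡ (eval-monomial r u)) ⟩
      - 1# + u ^ suc r                       ≈⟨ +-congˡ u^[q-1]≈1 ⟩
      - 1# + 1#                              ≈⟨ -‿inverseˡ 1# ⟩
      0#                                     ∎
      where
      u = root i
      u^[q-1]≈1 : u ^ suc r ≈ 1#
      u^[q-1]≈1 = *-cancelˡ-≉0 (unit-≉0 _) (trans (σ≈id u) (sym (*-identityʳ u)))
    Xq⁻¹-1[0]≉0 : ¬ eval Xq⁻¹-1 0# ≈ 0#
    Xq⁻¹-1[0]≉0 e = 1≉0 (begin
      1#                                     ≈⟨ -‿involutive 1# ⟨
      - - 1#                                 ≈⟨ -‿cong (+-identityʳ (- 1#)) ⟨
      - (- 1# + 0#)                          ≈⟨ -‿cong (+-congˡ (zeroˡ _)) ⟨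
      - eval Xq⁻¹-1 0#                       ≈⟨ -‿cong e ⟩
      - 0#                                   ≈⟨ -0#≈0# ⟩
      0#                                     ∎)

  two : Carrier
  two = 1# + 1#

  two≉0 : ¬ two ≈ 0#
  two≉0 2≈0 = 1≉0 (trans (sym (1+1≈0⇒odd×1≈1 p-odd 2≈0)) p×1≈0)

  four≉0 : ¬ four ≈ 0#
  four≉0 = x≉0∧y≉0⇒x*y≉0 two≉0 two≉0 ∘ trans (solve 0 (con (+ 2) :* con (+ 2) := con (+ 4)) refl)

  σ-two : σ two ≈ two
  σ-two = trans (σ-+ 1# 1#) (+-cong σ-1 σ-1)

  σ-four : σ four ≈ four
  σ-four = trans (σ-+ _ 1#) (+-cong (trans (σ-+ two 1#) (+-cong σ-two σ-1)) σ-1)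

  σ-inverse : ∀ {x y} → x * y ≈ 1# → σ x * σ y ≈ 1#
  σ-inverse {x} {y} xy≈1 = trans (sym (σ-* x y)) (trans (σ-cong xy≈1) σ-1)

  σ-^2 : ∀ x → σ (x ^ 2) ≈ σ x ^ 2
  σ-^2 x = trans (σ-* x (x * 1#)) (*-congˡ (trans (σ-* x 1#) (*-congˡ σ-1)))

  T : Carrier → Carrier
  T x = σ x - x

  σ-T : ∀ x → σ (T x) ≈ - T x
  σ-T x = begin
    σ (σ x - x)            ≈⟨ σ-+ (σ x) (- x) ⟩
    σ (σ x) + σ (- x)      ≈⟨ +-cong (σ-involutive x) (σ-‿ x) ⟩
    x - σ x                ≈⟨ solve 2 (λ x a → x :- a := :- (a :- x)) refl x (σ x) ⟩
    - (σ x - x)            ∎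

  T-+ : ∀ x y → T (x + y) ≈ T x + T y
  T-+ x y = trans (+-congʳ (σ-+ x y))
    (solve 4 (λ x y a b → (a :+ b) :- (x :+ y) := (a :- x) :+ (b :- y)) refl x y (σ x) (σ y))

  T≈0⇒σ-fixed : ∀ {x} → T x ≈ 0# → InSubfield q x
  T≈0⇒σ-fixed = x∙y⁻¹≈ε⇒x≈y _ _

  T-quarter : ∀ {y} → σ y ≈ - y → two * T (y * four ⁻¹) ≈ - y
  T-quarter {y} σy≈-y = begin
    two * (σ (y * ¼) - y * ¼)       ≈⟨ *-congˡ (+-congʳ (trans (σ-* y ¼) (*-cong σy≈-y σ¼≈¼))) ⟩
    two * (- y * ¼ - y * ¼)
      ≈⟨ solve 2 (λ y i → con (+ 2) :* ((:- y) :* i :- y :* i) := (:- y) :* (con (+ 4) :* i)) refl y ¼ ⟩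
    - y * (four * ¼)                ≈⟨ *-congˡ 4¼≈1 ⟩
    - y * 1#                        ≈⟨ *-identityʳ (- y) ⟩
    - y                             ∎
    where
    ¼ = four ⁻¹
    4¼≈1 : four * ¼ ≈ 1#
    4¼≈1 = ⁻¹-inverse four four≉0
    σ¼≈¼ : σ ¼ ≈ ¼
    σ¼≈¼ = inverse-unique (trans (*-congʳ (sym σ-four)) (σ-inverse 4¼≈1)) 4¼≈1

  module Polynomial (γ δ : Carrier) where

    f : Carrier → Carrier
    f x = ((((x ^ q) - x) + δ) ^ 2) + (γ * x)

    z : Carrier
    z = γ - two * Tr q δ

    f-cong : ∀ {x y} → x ≈ y → f x ≈ f y
    f-cong x≈y = +-cong (^-congˡ 2 (+-congʳ (+-cong (σ-cong x≈y) (-‿cong x≈y)))) (*-congˡ x≈y)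

    σ-z : σ z ≈ σ γ - two * Tr q δ
    σ-z = begin
      σ (γ - two * Tr q δ)             ≈⟨ σ-+ γ _ ⟩
      σ γ + σ (- (two * Tr q δ))       ≈⟨ +-congˡ (σ-‿ _) ⟩
      σ γ - σ (two * Tr q δ)           ≈⟨ +-congˡ (-‿cong (trans (σ-* two _) (*-cong σ-two (σ-Tr δ)))) ⟩
      σ γ - two * Tr q δ               ∎

    σ[f]-f : ∀ x → σ (f x) - f x ≈ (σ δ * σ δ - δ * δ) + (σ (z * x) - z * x)
    σ[f]-f x = begin
      σ (f x) - f x                                         ≈⟨ +-congʳ σ-f ⟩
      ((- T x + σ δ) ^ 2 + σ γ * σ x) - f x                 ≈⟨ solve 6 (λ x a d e g h →
          ((:- (a :- x) :+ e) :^ 2 :+ h :* a) :- (((a :- x) :+ d) :^ 2 :+ g :* x)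
          := (e :* e :- d :* d) :+ ((h :- con (+ 2) :* (d :+ e)) :* a :- (g :- con (+ 2) :* (d :+ e)) :* x))
          refl x (σ x) δ (σ δ) γ (σ γ) ⟩
      (σ δ * σ δ - δ * δ) + ((σ γ - two * Tr q δ) * σ x - z * x)
                                                            ≈⟨ +-congˡ (+-congʳ (trans (σ-* z x) (*-congʳ σ-z))) ⟨
      (σ δ * σ δ - δ * δ) + (σ (z * x) - z * x)             ∎
      where
      σ-f : σ (f x) ≈ (- T x + σ δ) ^ 2 + σ γ * σ x
      σ-f = trans (σ-+ _ _) (+-cong (trans (σ-^2 _) (^-congˡ 2 (trans (σ-+ (T x) δ) (+-congʳ (σ-T x))))) (σ-* γ x))

    z∈𝔽q*⇒f-injective : ¬ γ ≈ 0# → InSubfield q z → ¬ z ≈ 0# → Injective _≈_ _≈_ f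
    z∈𝔽q*⇒f-injective γ≉0 σz≈z z≉0 {x} {y} fx≈fy = *-cancelˡ-≉0 γ≉0 (+-cancelˡ _ _ _ squares≈)
      where
      C = σ δ * σ δ - δ * δ
      σ[zx]-zx : ∀ x → σ (z * x) - z * x ≈ z * T x
      σ[zx]-zx x = trans (+-congʳ (trans (σ-* z x) (*-congʳ σz≈z))) (sym (x[y-z]≈xy-xz z (σ x) x))
      zTx≈zTy : z * T x ≈ z * T y
      zTx≈zTy = +-cancelˡ C _ _ (begin
        C + z * T x                    ≈⟨ +-congˡ (σ[zx]-zx x) ⟨
        C + (σ (z * x) - z * x)        ≈⟨ σ[f]-f x ⟨
        σ (f x) - f x                  ≈⟨ +-cong (σ-cong fx≈fy) (-‿cong fx≈fy) ⟩
        σ (f y) - f y                  ≈⟨ σ[f]-f y ⟩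
        C + (σ (z * y) - z * y)        ≈⟨ +-congˡ (σ[zx]-zx y) ⟩
        C + z * T y                    ∎)
      squares≈ : (T x + δ) ^ 2 + γ * x ≈ (T x + δ) ^ 2 + γ * y
      squares≈ = trans fx≈fy (+-congʳ (^-congˡ 2 (+-congʳ (sym (*-cancelˡ-≉0 z≉0 zTx≈zTy)))))

    f-difference : ∀ x h → f (x + h) - f x ≈ T h * (two * (T x + δ) + T h) + γ * h
    f-difference x h = begin
      f (x + h) - f x                                       ≈⟨ +-congʳ (+-congʳ (^-congˡ 2 (+-congʳ (T-+ x h)))) ⟩
      ((T x + T h + δ) ^ 2 + γ * (x + h)) - f x             ≈⟨ solve 6 (λ a b d g x h →
          ((a :+ b :+ d) :^ 2 :+ g :* (x :+ h)) :- ((a :+ d) :^ 2 :+ g :* x)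
          := b :* (con (+ 2) :* (a :+ d) :+ b) :+ g :* h) refl (T x) (T h) δ γ x h ⟩
      T h * (two * (T x + δ) + T h) + γ * h                 ∎

    ρ : Carrier → Carrier
    ρ h = two * δ + T h + γ * h * T h ⁻¹

    σ-ρ : ∀ {h} → ¬ T h ≈ 0# → InSubfield q (z * h) → σ (ρ h) ≈ - ρ h
    σ-ρ {h} t≉0 σ[zh]≈zh = begin
      σ (two * δ + t + γ * h * s)                           ≈⟨ trans (σ-+ _ _) (+-cong (σ-+ _ _) (σ-* _ _)) ⟩
      σ (two * δ) + σ t + σ (γ * h) * σ s
        ≈⟨ +-cong (+-cong (trans (σ-* two δ) (*-congʳ σ-two)) (σ-T h)) (*-cong (σ-* γ h) σs≈-s) ⟩
      two * σ δ + - t + σ γ * σ h * - s                     ≈⟨ +-congˡ (*-congʳ σγσh≈) ⟩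
      two * σ δ + - t + (γ * h + two * Tr q δ * t) * - s    ≈⟨ solve 6 (λ d e g h t s →
          con (+ 2) :* e :+ :- t :+ (g :* h :+ con (+ 2) :* (d :+ e) :* t) :* :- s
          := :- (con (+ 2) :* d :+ t :+ g :* h :* s) :+ con (+ 2) :* (d :+ e) :* (con (+ 1) :- t :* s))
          refl δ (σ δ) γ h t s ⟩
      - ρ h + two * Tr q δ * (1# - t * s)                   ≈⟨ +-congˡ (*-congˡ (x≈y⇒x∙y⁻¹≈ε (sym ts≈1))) ⟩
      - ρ h + two * Tr q δ * 0#                             ≈⟨ trans (+-congˡ (zeroʳ _)) (+-identityʳ _) ⟩
      - ρ h                                                 ∎
      where
      t = T h
      s = t ⁻¹
      ts≈1 : t * s ≈ 1#
      ts≈1 = ⁻¹-inverse t t≉0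
      σs≈-s : σ s ≈ - s
      σs≈-s = inverse-unique (trans (*-congʳ (sym (σ-T h))) (σ-inverse ts≈1))
                             (trans (solve 2 (λ t s → :- t :* :- s := t :* s) refl t s) ts≈1)
      σγσh≈ : σ γ * σ h ≈ γ * h + two * Tr q δ * t
      σγσh≈ = begin
        σ γ * σ h
          ≈⟨ solve 3 (λ a h u → a :* h := (a :- u) :* h :+ u :* h) refl (σ γ) (σ h) (two * Tr q δ) ⟩
        (σ γ - two * Tr q δ) * σ h + two * Tr q δ * σ h
          ≈⟨ +-congʳ (trans (*-congʳ (sym σ-z)) (trans (sym (σ-* z h)) σ[zh]≈zh)) ⟩
        (γ - two * Tr q δ) * h + two * Tr q δ * σ h
          ≈⟨ solve 4 (λ g u h a → (g :- u) :* h :+ u :* a := g :* h :+ u :* (a :- h)) refl γ (two * Tr q δ) h (σ h) ⟩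
        γ * h + two * Tr q δ * t
          ∎

    collision : ∀ {h} → ¬ T h ≈ 0# → InSubfield q (z * h) →
                f (ρ h * four ⁻¹ + h) ≈ f (ρ h * four ⁻¹)
    collision {h} t≉0 σ[zh]≈zh = x∙y⁻¹≈ε⇒x≈y _ _ (begin
      f (x + h) - f x                                      ≈⟨ f-difference x h ⟩
      t * (two * (T x + δ) + t) + γ * h
        ≈⟨ +-congʳ (*-congˡ (+-congʳ (trans (distribˡ two (T x) δ) (+-congʳ 2Tx≈-ρ)))) ⟩
      t * ((- ρ h + two * δ) + t) + γ * h                  ≈⟨ solve 5 (λ t d g h s →
          t :* ((:- (con (+ 2) :* d :+ t :+ g :* h :* s) :+ con (+ 2) :* d) :+ t) :+ g :* h
          := g :* h :* (con (+ 1) :- t :* s)) refl t δ γ h (t ⁻¹) ⟩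
      γ * h * (1# - t * t ⁻¹)                              ≈⟨ *-congˡ (x≈y⇒x∙y⁻¹≈ε (sym (⁻¹-inverse t t≉0))) ⟩
      γ * h * 0#                                           ≈⟨ zeroʳ _ ⟩
      0#                                                   ∎)
      where
      t = T h
      x = ρ h * four ⁻¹
      2Tx≈-ρ : two * T x ≈ - ρ h
      2Tx≈-ρ = T-quarter (σ-ρ t≉0 σ[zh]≈zh)

    f-injective⇒σ-fixed : Injective _≈_ _≈_ f → ∀ {h} → InSubfield q (z * h) → InSubfield q h
    f-injective⇒σ-fixed f-inj {h} σ[zh]≈zh = ≈-stable λ h∉𝔽q → h∉𝔽q (begin
      σ h                  ≈⟨ σ-cong (h≈0 h∉𝔽q) ⟩
      σ 0#                 ≈⟨ σ-0 ⟩
      0#                   ≈⟨ h≈0 h∉𝔽q ⟨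
      h                    ∎)
      where
      h≈0 : ¬ InSubfield q h → h ≈ 0#
      h≈0 h∉𝔽q = identityʳ-unique _ h (f-inj (collision (h∉𝔽q ∘ T≈0⇒σ-fixed) σ[zh]≈zh))

    f-injective⇒z∈𝔽q* : Injective _≈_ _≈_ f → InSubfield q z × ¬ z ≈ 0#
    f-injective⇒z∈𝔽q* f-inj = σz≈z , z≉0
      where
      z≉0 : ¬ z ≈ 0#
      z≉0 z≈0 = σ-not-identity λ h → f-injective⇒σ-fixed f-inj (begin
        σ (z * h)          ≈⟨ σ-cong (zh≈0 h) ⟩
        σ 0#               ≈⟨ σ-0 ⟩
        0#                 ≈⟨ zh≈0 h ⟨
        z * h              ∎)
        where
        zh≈0 : ∀ h → z * h ≈ 0#
        zh≈0 h = trans (*-congʳ z≈0) (zeroˡ h)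
      σz≈z : InSubfield q z
      σz≈z = inverse-unique {z ⁻¹}
        (trans (*-comm _ _) (trans (*-congˡ (sym σz⁻¹≈z⁻¹)) (σ-inverse zz⁻¹≈1)))
        (trans (*-comm _ _) zz⁻¹≈1)
        where
        zz⁻¹≈1 : z * z ⁻¹ ≈ 1#
        zz⁻¹≈1 = ⁻¹-inverse z z≉0
        σz⁻¹≈z⁻¹ : InSubfield q (z ⁻¹)
        σz⁻¹≈z⁻¹ = f-injective⇒σ-fixed f-inj (trans (σ-cong zz⁻¹≈1) (trans σ-1 (sym zz⁻¹≈1)))

    f-permutation⇔z∈𝔽q* : ¬ γ ≈ 0# → IsPermutation f ⇔ (InSubfield q z × ¬ z ≈ 0#)
    f-permutation⇔z∈𝔽q* γ≉0 = mk⇔ (f-injective⇒z∈𝔽q* ∘ proj₁)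
      (λ (σz≈z , z≉0) → injective⇒bijective f-cong (z∈𝔽q*⇒f-injective γ≉0 σz≈z z≉0))

    z∈𝔽q*⇔γ∈𝔽q∧D≉0 : (InSubfield q z × ¬ z ≈ 0#) ⇔
                     (InSubfield q γ × ¬ Tr q δ - Tr q γ * four ⁻¹ ≈ 0#)
    z∈𝔽q*⇔γ∈𝔽q∧D≉0 = mk⇔
      (λ (σz≈z , z≉0) → σz≈z⇒σγ≈γ σz≈z , z≉0 ∘ D≈0⇒z≈0 (σz≈z⇒σγ≈γ σz≈z))
      (λ (σγ≈γ , D≉0) → σγ≈γ⇒σz≈z σγ≈γ , D≉0 ∘ z≈0⇒D≈0 σγ≈γ)
      where
      D = Tr q δ - Tr q γ * four ⁻¹
      σz≈z⇒σγ≈γ : InSubfield q z → InSubfield q γ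
      σz≈z⇒σγ≈γ σz≈z = +-cancelʳ (- (two * Tr q δ)) _ _ (trans (sym σ-z) σz≈z)
      σγ≈γ⇒σz≈z : InSubfield q γ → InSubfield q z
      σγ≈γ⇒σz≈z σγ≈γ = trans σ-z (+-congʳ σγ≈γ)
      z≈-2D : InSubfield q γ → z ≈ - (two * D)
      z≈-2D σγ≈γ = begin
        γ - two * Tr q δ                                    ≈⟨ +-identityʳ _ ⟨
        (γ - two * Tr q δ) + 0#
          ≈⟨ +-congˡ (trans (*-congˡ (x≈y⇒x∙y⁻¹≈ε (⁻¹-inverse four four≉0))) (zeroʳ γ)) ⟨
        (γ - two * Tr q δ) + γ * (four * four ⁻¹ - 1#)      ≈⟨ solve 3 (λ g t i →
            (g :- con (+ 2) :* t) :+ g :* (con (+ 4) :* i :- con (+ 1)) := :- (con (+ 2) :* (t :- (g :+ g) :* i)))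
            refl γ (Tr q δ) (four ⁻¹) ⟩
        - (two * (Tr q δ - (γ + γ) * four ⁻¹))
          ≈⟨ -‿cong (*-congˡ (+-congˡ (-‿cong (*-congʳ (+-congˡ σγ≈γ))))) ⟨
        - (two * D)                                         ∎
      D≈0⇒z≈0 : InSubfield q γ → D ≈ 0# → z ≈ 0#
      D≈0⇒z≈0 σγ≈γ D≈0 = trans (z≈-2D σγ≈γ) (trans (-‿cong (trans (*-congˡ D≈0) (zeroʳ two))) -0#≈0#)
      z≈0⇒D≈0 : InSubfield q γ → z ≈ 0# → D ≈ 0#
      z≈0⇒D≈0 σγ≈γ z≈0 = x*y≈0⇒y≈0 two≉0
        (trans (sym (-‿involutive _)) (trans (-‿cong (trans (sym (z≈-2D σγ≈γ)) z≈0)) -0#≈0#))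

open import Data.Product using (_×_; _,_)
open import Data.Nat using (_≤_; s≤s; z≤n; nonTrivial⇒n>1)
open import Data.Nat.Properties using (≤-trans; m≤m*n; m^n≢0)
open import Data.Nat.Primality using (prime⇒nonTrivial; prime⇒nonZero)
open import Data.Nat.Divisibility using (_∣_; ∣m⇒∣m*n)
open import Function.Construct.Composition using (_⇔-∘_)
open import Relation.Binary.PropositionalEquality using (refl; sym; subst)

prime-power≥2 : ∀ {q} → IsPrimePower q → 2 ≤ q
prime-power≥2 (p , k , p-prime , refl) =
  ≤-trans (nonTrivial⇒n>1 p) (m≤m*n p (p ^ℕ k) {{m^n≢0 p k}})
  where instance
    _ = prime⇒nonTrivial p-prime
    _ = prime⇒nonZero p-prime

theorem3p2 : ∀ {c ℓ : Level} (q : ℕ) → IsPrimePower q → Odd q →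
    (F : Field c ℓ) → HasCardinality F (q *ℕ q) →
    let open Field F in
    (γ δ : Carrier) → ¬ (γ ≈ 0#) →
    IsPermutation (λ x → ((((x ^ q) - x) + δ) ^ 2) + (γ * x))
      ⇔ (InSubfield q γ × ¬ (((Tr q δ) - ((Tr q γ) * (four ⁻¹))) ≈ 0#))
theorem3p2 q q-prime-power@(p , k , p-prime , q≡p^[1+k]) q-odd F card γ δ γ≉0
  with prime-power≥2 q-prime-power
... | s≤s (s≤s {n = r} z≤n) = z∈𝔽q*⇔γ∈𝔽q∧D≉0 ⇔-∘ f-permutation⇔z∈𝔽q* γ≉0
  where
  p-odd : Odd p
  p-odd 2∣p = q-odd (subst (2 ∣_) (sym q≡p^[1+k]) (∣m⇒∣m*n (p ^ℕ k) 2∣p))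
  open QuadraticExtension F {k = k} p-prime p-odd r q≡p^[1+k] card
  open Polynomial γ δ
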